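{- Let $\Delta$ be a positive integer and let $a,b\in\mathbb{Z}^2$ be such that $M(a,b)$ is a generic $\Delta$-submodular matrix of type $2$. Then the number of columns of $M(a,b)$ is at most $\Delta+3$ if $\Delta$ is odd, and at most $\Delta+2$ if $\Delta$ is even.
   Context: All matrices are integer matrices with pairwise distinct columns. For $A\in\mathbb{Z}^{2\times n}$ of rank $2$, $A$ is $\Delta$-submodular if all its $2\times 2$ minors have absolute value at most $\Delta$, and generic if any two columns are linearly independent. For $a,b\in\mathbb{Z}^2$, $M(a,b)$ (type $2$) is the $2$-row matrix whose columns are $(0,1)^\intercal$ together with all $(k,j)^\intercal$ with $k\in\{1,2\}$, $a_k\leq j\leq b_k$, $\gcd(j,k)=1$. -}

module Defs where

open import Data.Nat as ℕ using (ℕ; zero; suc)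
open import Data.Integer as ℤ using (ℤ; +_; -[1+_]; _-_; _*_; _+_; ∣_∣)
open import Data.Integer.GCD using (gcd)
open import Data.Product using (_×_; _,_; proj₁; proj₂; Σ-syntax)
open import Data.List using (List; []; _∷_; map; filter; upTo; _++_; length)
open import Data.List.Membership.Propositional using (_∈_)
open import Relation.Binary.PropositionalEquality using (_≡_; _≢_)

-- A column vector in ℤ²: (first row entry, second row entry).
Col : Set
Col = ℤ × ℤ

det : Col → Col → ℤ
det (u₁ , u₂) (v₁ , v₂) = u₁ * v₂ - u₂ * v₁

range : ℤ → ℤ → List ℤ
range a b with b - a
... | + n      = map (λ i → a + + i) (upTo (suc n))
... | -[1+ n ] = []

colsOfType : ℤ → ℤ → ℤ → List Col
colsOfType k a b =
  map (λ j → (k , j)) (filter (λ j → gcd j k ℤ.≟ + 1) (range a b))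

M : ℤ × ℤ → ℤ × ℤ → List Col
M (a₁ , a₂) (b₁ , b₂) =
  (+ 0 , + 1) ∷ (colsOfType (+ 1) a₁ b₁ ++ colsOfType (+ 2) a₂ b₂)

ncols : List Col → ℕ
ncols = length

Rank2 : List Col → Set
Rank2 A = Σ[ u ∈ Col ] Σ[ v ∈ Col ] (u ∈ A × v ∈ A × det u v ≢ + 0)

Submodular : ℕ → List Col → Set
Submodular Δ A = Rank2 A × (∀ u v → u ∈ A → v ∈ A → ∣ det u v ∣ ℕ.≤ Δ)

-- Generic: any two (distinct) columns are linearly independent.
-- (Columns of M(a,b) are pairwise distinct by construction.)
Generic : List Col → Set
Generic A = ∀ u v → u ∈ A → v ∈ A → u ≢ v → det u v ≢ + 0

-- Let the columns other than (0,1) be (1,x) for x in X and (2,y) for y in Y. Both lists are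
-- increasing and the entries of Y are odd, so X spans at least |X| - 1 and Y at least 2(|Y| - 1).
-- With x, z₁ the extremes of X and y, z₂ those of Y, the two mixed minors satisfy
-- det((1,x),(2,z₂)) - det((1,z₁),(2,y)) = (z₂ - y) + 2(z₁ - x) ≥ 2(|X| + |Y| - 2),
-- while their absolute values are at most Δ; so |X| + |Y| ≤ Δ + 2. For even Δ the first minor,
-- being odd, is at most Δ - 1, which gains one. If only one type occurs, a single minor already
-- bounds its span.

module Submission where

open import Defs
open import Data.Nat using (ℕ; _≤_; _+_; _%_)
open import Data.Integer using (ℤ)
open import Data.Product using (_×_)
open import Relation.Binary.PropositionalEquality using (_≡_)

open import Data.Nat as ℕ using (suc; s≤s; z≤n)
import Data.Nat.Properties as ℕ
open import Data.Nat.Divisibility as ℕ using (m%n≡0⇒n∣m; ∣1⇒≡1)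
open import Data.Integer as ℤ using (+_; -[1+_]; _-_; ∣_∣; -_)
import Data.Integer.Properties as ℤ
open import Data.Integer.Divisibility.Signed as Div using (divides; ∣⇒∣ᵤ; ∣ᵤ⇒∣; ∣m∣n⇒∣m+n)
open import Data.Integer.GCD using (gcd; gcd-greatest)
open import Data.Integer.DivMod using (_%ℕ_; _/ℕ_; n%ℕd<d; a≡a%ℕn+[a/ℕn]*n)
open import Data.Integer.Tactic.RingSolver using (solve-∀)
open import Data.Product using (∃-syntax; _,_; proj₁; proj₂)
open import Data.Sum using (_⊎_; inj₁; inj₂)
open import Data.List using (List; []; _∷_; map; filter; length; _++_)
open import Data.List.Properties using (length-++; length-map)
open import Data.List.Membership.Propositional using (_∈_)
open import Data.List.Membership.Propositional.Properties using (∈-map⁺; ∈-++⁺ˡ; ∈-++⁺ʳ)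
open import Data.List.Relation.Unary.Any using (here; there)
open import Data.List.Relation.Unary.All as All using (All; _∷_)
open import Data.List.Relation.Unary.All.Properties using (all-filter)
open import Data.List.Relation.Unary.Linked as Linked using (Linked; []; [-]; _∷_)
import Data.List.Relation.Unary.Linked.Properties as Linked
open import Relation.Nullary using (¬_)
open import Relation.Binary.PropositionalEquality using (_≢_; refl; sym; trans; cong; cong₂; subst; module ≡-Reasoning)
open import Data.Empty using (⊥-elim)
open import Function using (id)

¬2∣1 : ¬ (2 ℕ.∣ 1)
¬2∣1 2∣1 with ∣1⇒≡1 2∣1
... | ()

Even : ℤ → Set
Even i = + 2 Div.∣ i

Odd : ℤ → Set
Odd i = ¬ Even i

coprime-2⇒odd : ∀ {j} → gcd j (+ 2) ≡ + 1 → Odd j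
coprime-2⇒odd {j} g 2∣j =
  ¬2∣1 (subst (λ d → 2 ℕ.∣ ∣ d ∣) g (gcd-greatest {j} {+ 2} {+ 2} (∣⇒∣ᵤ 2∣j) (ℕ.∣-refl {2})))

even⊎even-suc : ∀ i → Even i ⊎ Even (ℤ.suc i)
even⊎even-suc i = by-remainder (i %ℕ 2) (n%ℕd<d i 2) (a≡a%ℕn+[a/ℕn]*n i 2)
  where
  by-remainder : ∀ r → r ℕ.< 2 → i ≡ + r ℤ.+ (i /ℕ 2) ℤ.* + 2 → Even i ⊎ Even (ℤ.suc i)
  by-remainder 0 _ i≡ = inj₁ (divides (i /ℕ 2) (trans i≡ (ℤ.+-identityˡ _)))
  by-remainder 1 _ i≡ = inj₂ (divides (i /ℕ 2 ℤ.+ + 1) (trans (cong ℤ.suc i≡) (shift (i /ℕ 2))))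
    where
    shift : ∀ q → + 1 ℤ.+ (+ 1 ℤ.+ q ℤ.* + 2) ≡ (q ℤ.+ + 1) ℤ.* + 2
    shift = solve-∀
  by-remainder (suc (suc _)) (s≤s (s≤s ())) _

odd-suc⇒even : ∀ {i} → Odd i → Even (ℤ.suc i)
odd-suc⇒even {i} odd with even⊎even-suc i
... | inj₁ even = ⊥-elim (odd even)
... | inj₂ even = even

odd⇒odd-det₁₂ : ∀ x {z} → Odd z → Odd (det (+ 1 , x) (+ 2 , z))
odd⇒odd-det₁₂ x {z} odd 2∣d = odd (subst Even (restore x z) (∣m∣n⇒∣m+n 2∣d (divides x refl)))
  where
  restore : ∀ x z → + 1 ℤ.* z - x ℤ.* + 2 ℤ.+ x ℤ.* + 2 ≡ z
  restore = solve-∀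

Gap : ℕ → ℤ → ℤ → Set
Gap g u v = + g ℤ.+ u ℤ.≤ v

<⇒gap-1 : ∀ {u v} → u ℤ.< v → Gap 1 u v
<⇒gap-1 = ℤ.i<j⇒suc[i]≤j

odd<odd⇒gap-2 : ∀ {u v} → Odd u → Odd v → u ℤ.< v → Gap 2 u v
odd<odd⇒gap-2 {u} {v} odd-u odd-v u<v =
  subst (ℤ._≤ v) (two+ u) (ℤ.i<j⇒suc[i]≤j (ℤ.≤∧≢⇒< (<⇒gap-1 u<v) suc-u≢v))
  where
  two+ : ∀ u → + 1 ℤ.+ (+ 1 ℤ.+ u) ≡ + 2 ℤ.+ u
  two+ = solve-∀
  suc-u≢v : ℤ.suc u ≢ v
  suc-u≢v eq = odd-v (subst Even eq (odd-suc⇒even odd-u))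

i+j≤k⇒i≤k-j : ∀ {i j k} → i ℤ.+ j ℤ.≤ k → i ℤ.≤ k - j
i+j≤k⇒i≤k-j {i} {j} {k} p = subst (ℤ._≤ k - j) (cancel i j) (ℤ.+-monoˡ-≤ (- j) p)
  where
  cancel : ∀ i j → i ℤ.+ j - j ≡ i
  cancel = solve-∀

gapped-span : ∀ {g x xs} → Linked (Gap g) (x ∷ xs) →
  ∃[ z ] z ∈ x ∷ xs × + length xs ℤ.* + g ℤ.≤ z - x
gapped-span {x = x} [-] = x , here refl , ℤ.≤-reflexive (sym (ℤ.+-inverseʳ x))
gapped-span {g} {x} {y ∷ ys} (gap ∷ gaps) with gapped-span gaps
... | z , z∈ , span = z , there z∈ , (begin
  + length (y ∷ ys) ℤ.* + g        ≡⟨ unfold (+ length ys) (+ g) ⟩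
  + length ys ℤ.* + g ℤ.+ + g      ≤⟨ ℤ.+-mono-≤ span (i+j≤k⇒i≤k-j gap) ⟩
  (z - y) ℤ.+ (y - x)              ≡⟨ ℤ.+-minus-telescope z y x ⟩
  z - x                            ∎)
  where
  open ℤ.≤-Reasoning
  unfold : ∀ n g → (+ 1 ℤ.+ n) ℤ.* g ≡ n ℤ.* g ℤ.+ g
  unfold = solve-∀

+≤⇒≤∣∣ : ∀ {k i} → + k ℤ.≤ i → k ≤ ∣ i ∣
+≤⇒≤∣∣ (ℤ.+≤+ k≤n) = k≤n

MinorsBounded : ℕ → List Col → Set
MinorsBounded Δ A = ∀ {u v} → u ∈ A → v ∈ A → ∣ det u v ∣ ≤ Δ

columns : ℤ → List ℤ → List Col
columns k = map (k ,_)

length-columns : ∀ k X → length (columns k X) ≡ length X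
length-columns k = length-map (k ,_)

columns₁₂ : List ℤ → List ℤ → List Col
columns₁₂ X Y = columns (+ 1) X ++ columns (+ 2) Y

module _ {Δ : ℕ} {X Y : List ℤ} (bounded : MinorsBounded Δ (columns₁₂ X Y)) where

  bounded₁₁ : ∀ {u v} → u ∈ X → v ∈ X → ∣ det (+ 1 , u) (+ 1 , v) ∣ ≤ Δ
  bounded₁₁ u∈ v∈ = bounded (∈-++⁺ˡ (∈-map⁺ (+ 1 ,_) u∈)) (∈-++⁺ˡ (∈-map⁺ (+ 1 ,_) v∈))

  bounded₁₂ : ∀ {u v} → u ∈ X → v ∈ Y → ∣ det (+ 1 , u) (+ 2 , v) ∣ ≤ Δ
  bounded₁₂ u∈ v∈ = bounded (∈-++⁺ˡ (∈-map⁺ (+ 1 ,_) u∈)) (∈-++⁺ʳ (columns (+ 1) X) (∈-map⁺ (+ 2 ,_) v∈))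

  bounded₂₂ : ∀ {u v} → u ∈ Y → v ∈ Y → ∣ det (+ 2 , u) (+ 2 , v) ∣ ≤ Δ
  bounded₂₂ u∈ v∈ = bounded (∈-++⁺ʳ (columns (+ 1) X) (∈-map⁺ (+ 2 ,_) u∈)) (∈-++⁺ʳ (columns (+ 1) X) (∈-map⁺ (+ 2 ,_) v∈))

span⇒≤det₁₁ : ∀ {k x z} → + k ℤ.* + 1 ℤ.≤ z - x → k ≤ ∣ det (+ 1 , x) (+ 1 , z) ∣
span⇒≤det₁₁ {k} {x} {z} span = +≤⇒≤∣∣ (begin
  + k                       ≡⟨ sym (ℤ.*-identityʳ (+ k)) ⟩
  + k ℤ.* + 1               ≤⟨ span ⟩
  z - x                     ≡⟨ expand x z ⟩
  + 1 ℤ.* z - x ℤ.* + 1     ∎)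
  where
  open ℤ.≤-Reasoning
  expand : ∀ x z → z - x ≡ + 1 ℤ.* z - x ℤ.* + 1
  expand = solve-∀

span⇒≤det₂₂ : ∀ {k y z} → + k ℤ.* + 2 ℤ.≤ z - y → 4 ℕ.* k ≤ ∣ det (+ 2 , y) (+ 2 , z) ∣
span⇒≤det₂₂ {k} {y} {z} span = +≤⇒≤∣∣ (begin
  + (4 ℕ.* k)                        ≡⟨ ℤ.pos-* 4 k ⟩
  + 4 ℤ.* + k                        ≡⟨ regroup (+ k) ⟩
  + k ℤ.* + 2 ℤ.+ + k ℤ.* + 2        ≤⟨ ℤ.+-mono-≤ span span ⟩
  (z - y) ℤ.+ (z - y)                ≡⟨ expand y z ⟩
  + 2 ℤ.* z - y ℤ.* + 2              ∎)
  where
  open ℤ.≤-Reasoning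
  regroup : ∀ k → + 4 ℤ.* k ≡ k ℤ.* + 2 ℤ.+ k ℤ.* + 2
  regroup = solve-∀
  expand : ∀ y z → (z - y) ℤ.+ (z - y) ≡ + 2 ℤ.* z - y ℤ.* + 2
  expand = solve-∀

spans⇒≤det₁₂-det₁₂ : ∀ {m n x z₁ y z₂} → + m ℤ.* + 1 ℤ.≤ z₁ - x → + n ℤ.* + 2 ℤ.≤ z₂ - y →
  2 ℕ.* (m ℕ.+ n) ≤ ∣ det (+ 1 , x) (+ 2 , z₂) - det (+ 1 , z₁) (+ 2 , y) ∣
spans⇒≤det₁₂-det₁₂ {m} {n} {x} {z₁} {y} {z₂} span₁ span₂ = +≤⇒≤∣∣ (begin
  + (2 ℕ.* (m ℕ.+ n))                                ≡⟨ ℤ.pos-* 2 (m ℕ.+ n) ⟩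
  + 2 ℤ.* (+ m ℤ.+ + n)                              ≡⟨ regroup (+ m) (+ n) ⟩
  (+ m ℤ.* + 1 ℤ.+ + m ℤ.* + 1) ℤ.+ + n ℤ.* + 2      ≤⟨ ℤ.+-mono-≤ (ℤ.+-mono-≤ span₁ span₁) span₂ ⟩
  ((z₁ - x) ℤ.+ (z₁ - x)) ℤ.+ (z₂ - y)               ≡⟨ expand x z₁ y z₂ ⟩
  (+ 1 ℤ.* z₂ - x ℤ.* + 2) - (+ 1 ℤ.* y - z₁ ℤ.* + 2) ∎)
  where
  open ℤ.≤-Reasoning
  regroup : ∀ m n → + 2 ℤ.* (m ℤ.+ n) ≡ (m ℤ.* + 1 ℤ.+ m ℤ.* + 1) ℤ.+ n ℤ.* + 2
  regroup = solve-∀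
  expand : ∀ x z₁ y z₂ → ((z₁ - x) ℤ.+ (z₁ - x)) ℤ.+ (z₂ - y) ≡ (+ 1 ℤ.* z₂ - x ℤ.* + 2) - (+ 1 ℤ.* y - z₁ ℤ.* + 2)
  expand = solve-∀

LengthBound : ℕ → ℕ → Set
LengthBound Δ L = L ≤ 2 + Δ × (2 ℕ.∣ Δ → L ≤ 1 + Δ)

≤1+⇒LengthBound : ∀ {L Δ} → L ≤ 1 + Δ → LengthBound Δ L
≤1+⇒LengthBound L≤1+Δ = ℕ.m≤n⇒m≤1+n L≤1+Δ , λ _ → L≤1+Δ

length-bound-columns₁₂ : ∀ {Δ} X Y → Linked (Gap 1) X → Linked (Gap 2) Y → All Odd Y →
  MinorsBounded Δ (columns₁₂ X Y) → LengthBound Δ (length X + length Y)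
length-bound-columns₁₂ [] [] _ _ _ _ = z≤n , λ _ → z≤n
length-bound-columns₁₂ {Δ} (x ∷ xs) [] gaps₁ _ _ bounded with gapped-span gaps₁
... | z , z∈ , span = ≤1+⇒LengthBound (s≤s (subst (_≤ Δ) (sym (ℕ.+-identityʳ _)) m≤Δ))
  where
  m≤Δ : length xs ≤ Δ
  m≤Δ = ℕ.≤-trans (span⇒≤det₁₁ {length xs} {x} {z} span) (bounded₁₁ bounded (here refl) z∈)
length-bound-columns₁₂ {Δ} [] (y ∷ ys) _ gaps₂ _ bounded with gapped-span gaps₂
... | z , z∈ , span = ≤1+⇒LengthBound (s≤s n≤Δ)
  where
  n≤Δ : length ys ≤ Δ
  n≤Δ = ℕ.≤-trans (ℕ.m≤n*m _ 4)
    (ℕ.≤-trans (span⇒≤det₂₂ {length ys} {y} {z} span) (bounded₂₂ {X = []} bounded (here refl) z∈))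
length-bound-columns₁₂ {Δ} (x ∷ xs) (y ∷ ys) gaps₁ gaps₂ odds bounded
  with gapped-span gaps₁ | gapped-span gaps₂
... | z₁ , z₁∈ , span₁ | z₂ , z₂∈ , span₂ =
  subst (_≤ 2 + Δ) (sym count) (s≤s (s≤s m+n≤Δ)) ,
  λ 2∣Δ → subst (_≤ 1 + Δ) (sym count) (s≤s (m+n<Δ 2∣Δ))
  where
  m = length xs
  n = length ys
  d₁ = det (+ 1 , x) (+ 2 , z₂)
  d₂ = det (+ 1 , z₁) (+ 2 , y)
  count : suc m + suc n ≡ 2 + (m + n)
  count = cong suc (ℕ.+-suc m n)
  d₁≤Δ : ∣ d₁ ∣ ≤ Δ
  d₁≤Δ = bounded₁₂ bounded (here refl) z₂∈
  d₂≤Δ : ∣ d₂ ∣ ≤ Δ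
  d₂≤Δ = bounded₁₂ bounded z₁∈ (here refl)
  twice : 2 ℕ.* (m + n) ≤ ∣ d₁ ∣ + ∣ d₂ ∣
  twice = ℕ.≤-trans (spans⇒≤det₁₂-det₁₂ {m} {n} {x} {z₁} {y} {z₂} span₁ span₂) (ℤ.∣i-j∣≤∣i∣+∣j∣ d₁ d₂)
  m+n≤Δ : m + n ≤ Δ
  m+n≤Δ = ℕ.*-cancelˡ-≤ 2 (ℕ.≤-trans twice (ℕ.+-mono-≤ d₁≤Δ (ℕ.m≤n⇒m≤n+o 0 d₂≤Δ)))
  d₁≢Δ : 2 ℕ.∣ Δ → ∣ d₁ ∣ ≢ Δ
  d₁≢Δ 2∣Δ eq = odd⇒odd-det₁₂ x (All.lookup odds z₂∈) (∣ᵤ⇒∣ (subst (2 ℕ.∣_) (sym eq) 2∣Δ))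
  m+n<Δ : 2 ℕ.∣ Δ → m + n ℕ.< Δ
  m+n<Δ 2∣Δ = ℕ.*-cancelˡ-< 2 _ _
    (ℕ.≤-<-trans twice (ℕ.+-mono-<-≤ (ℕ.≤∧≢⇒< d₁≤Δ (d₁≢Δ 2∣Δ)) (ℕ.m≤n⇒m≤n+o 0 d₂≤Δ)))

range-increasing : ∀ a b → Linked ℤ._<_ (range a b)
range-increasing a b with b - a
... | + n      = Linked.map⁺ (Linked.applyUpTo⁺₂ id (suc n) (λ i → ℤ.+-monoʳ-< a (ℤ.+<+ (ℕ.n<1+n i))))
... | -[1+ n ] = []

odd-increasing⇒gapped : ∀ {xs} → All Odd xs → Linked ℤ._<_ xs → Linked (Gap 2) xs
odd-increasing⇒gapped _ [] = []
odd-increasing⇒gapped _ [-] = [-]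
odd-increasing⇒gapped (odd-x ∷ odds@(odd-y ∷ _)) (x<y ∷ increasing) =
  odd<odd⇒gap-2 odd-x odd-y x<y ∷ odd-increasing⇒gapped odds increasing

coprimeRange : ℤ → ℤ → ℤ → List ℤ
coprimeRange k a b = filter (λ j → gcd j k ℤ.≟ + 1) (range a b)

coprimeRange-increasing : ∀ k a b → Linked ℤ._<_ (coprimeRange k a b)
coprimeRange-increasing k a b = Linked.filter⁺ (λ j → gcd j k ℤ.≟ + 1) ℤ.<-trans (range-increasing a b)

coprimeRange-2-odd : ∀ a b → All Odd (coprimeRange (+ 2) a b)
coprimeRange-2-odd a b = All.map coprime-2⇒odd (all-filter (λ j → gcd j (+ 2) ℤ.≟ + 1) (range a b))

ncols-M : ∀ a₁ a₂ b₁ b₂ →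
  ncols (M (a₁ , a₂) (b₁ , b₂)) ≡ suc (length (coprimeRange (+ 1) a₁ b₁) + length (coprimeRange (+ 2) a₂ b₂))
ncols-M a₁ a₂ b₁ b₂ = cong suc (begin
  length (columns (+ 1) X ++ columns (+ 2) Y)             ≡⟨ length-++ (columns (+ 1) X) ⟩
  length (columns (+ 1) X) + length (columns (+ 2) Y)     ≡⟨ cong₂ _+_ (length-columns (+ 1) X) (length-columns (+ 2) Y) ⟩
  length X + length Y                                     ∎)
  where
  open ≡-Reasoning
  X = coprimeRange (+ 1) a₁ b₁
  Y = coprimeRange (+ 2) a₂ b₂

claim3p9 : (Δ : ℕ) → 1 ≤ Δ → (a b : ℤ × ℤ) →
    Submodular Δ (M a b) → Generic (M a b) →
    (Δ % 2 ≡ 1 → ncols (M a b) ≤ Δ + 3) × (Δ % 2 ≡ 0 → ncols (M a b) ≤ Δ + 2)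
claim3p9 Δ _ (a₁ , a₂) (b₁ , b₂) (_ , minors) _ = odd-case , even-case
  where
  X = coprimeRange (+ 1) a₁ b₁
  Y = coprimeRange (+ 2) a₂ b₂
  bounds : LengthBound Δ (length X + length Y)
  bounds = length-bound-columns₁₂ X Y
    (Linked.map <⇒gap-1 (coprimeRange-increasing (+ 1) a₁ b₁))
    (odd-increasing⇒gapped (coprimeRange-2-odd a₂ b₂) (coprimeRange-increasing (+ 2) a₂ b₂))
    (coprimeRange-2-odd a₂ b₂)
    (λ u∈ v∈ → minors _ _ (there u∈) (there v∈))
  open ℕ.≤-Reasoning
  odd-case : Δ % 2 ≡ 1 → ncols (M (a₁ , a₂) (b₁ , b₂)) ≤ Δ + 3
  odd-case _ = begin
    ncols (M (a₁ , a₂) (b₁ , b₂)) ≡⟨ ncols-M a₁ a₂ b₁ b₂ ⟩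
    suc (length X + length Y)     ≤⟨ s≤s (proj₁ bounds) ⟩
    3 + Δ                         ≡⟨ ℕ.+-comm 3 Δ ⟩
    Δ + 3                         ∎
  even-case : Δ % 2 ≡ 0 → ncols (M (a₁ , a₂) (b₁ , b₂)) ≤ Δ + 2
  even-case Δ%2≡0 = begin
    ncols (M (a₁ , a₂) (b₁ , b₂)) ≡⟨ ncols-M a₁ a₂ b₁ b₂ ⟩
    suc (length X + length Y)     ≤⟨ s≤s (proj₂ bounds (m%n≡0⇒n∣m Δ 2 Δ%2≡0)) ⟩
    2 + Δ                         ≡⟨ ℕ.+-comm 2 Δ ⟩
    Δ + 2                         ∎
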